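{- Let $A=(1,a_1,\ldots,a_k)$ be an orderly currency with $k\geq 2$ and suppose $a_1<a_2-a_1+1<a_2-1$. Then there are no indices $0\leq i<j\leq k$ with $a_j-a_i=a_2-a_1+1$.
   Context: A currency is a finite sequence of integers $A=(a_0,a_1,\ldots,a_k)$ with $1=a_0<a_1<\cdots<a_k$. For an integer amount $c>0$, $\mathrm{opt}_A(c)$ is the minimum number of coins (values from $A$, repetitions allowed) summing to $c$, and $\mathrm{grd}_A(c)$ is the number of coins used by the greedy algorithm, which repeatedly takes the largest coin not exceeding the remaining amount. $A$ is orderly if $\mathrm{opt}_A(c)=\mathrm{grd}_A(c)$ for all integers $c>0$. -}

module Defs where

open import Data.Nat using (ℕ; zero; suc; _+_; _∸_; _≤_; _<_; _≤?_; _⊔_)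
open import Data.Fin using (Fin; toℕ)
import Data.Fin as F
open import Data.List using (List; []; _∷_; map; length)
open import Data.Nat.ListAction using (sum)
open import Data.List.Base using (allFin)
open import Data.Product using (_×_; Σ; ∃)
open import Relation.Nullary using (yes; no)
open import Relation.Binary.PropositionalEquality using (_≡_)

record IsCurrency (k : ℕ) (a : Fin (suc k) → ℕ) : Set where
  field
    a0≡1    : a F.zero ≡ 1
    strict  : ∀ (i j : Fin (suc k)) → toℕ i < toℕ j → a i < a j

Rep : (k : ℕ) → (Fin (suc k) → ℕ) → ℕ → List (Fin (suc k)) → Set
Rep k a c cs = sum (map a cs) ≡ c

IsOpt : (k : ℕ) → (Fin (suc k) → ℕ) → ℕ → ℕ → Set
IsOpt k a c m =
  (Σ (List (Fin (suc k))) λ cs → Rep k a c cs × length cs ≡ m)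
  × (∀ (cs : List (Fin (suc k))) → Rep k a c cs → m ≤ length cs)

-- largest element of the list not exceeding c (0 if none)
largestBelow : ℕ → List ℕ → ℕ
largestBelow c [] = 0
largestBelow c (x ∷ xs) with x ≤? c
... | yes _ = x ⊔ largestBelow c xs
... | no _  = largestBelow c xs

largestCoin : (k : ℕ) → (Fin (suc k) → ℕ) → ℕ → ℕ
largestCoin k a c = largestBelow c (map a (allFin (suc k)))

grdFuel : (k : ℕ) → (Fin (suc k) → ℕ) → ℕ → ℕ → ℕ
grdFuel k a zero c = 0
grdFuel k a (suc f) zero = 0
grdFuel k a (suc f) (suc c) = suc (grdFuel k a f (suc c ∸ largestCoin k a (suc c)))

-- grd_A(c); fuel c suffices since a_0 = 1 means each step removes at least 1.
grd : (k : ℕ) → (Fin (suc k) → ℕ) → ℕ → ℕ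
grd k a c = grdFuel k a c c

Orderly : (k : ℕ) → (Fin (suc k) → ℕ) → Set
Orderly k a = ∀ (c : ℕ) → 0 < c → IsOpt k a c (grd k a c)

module Submission where

-- Write d = a₂ - a₁ + 1.  The hypotheses say a₁ + d = a₂ + 1, a₁ < d and d + 2 ≤ a₂,
-- hence a₁ ≥ 3 and 2a₁ ≤ a₂; the coins below a₂ are only 1 and a₁.
--
-- Orderliness enters only through the two-coin property: if s = u + v is a sum of two
-- coins and g is the largest coin ≤ s, then s - g is 0 or a coin (greedy must pay s with
-- at most two coins).  We therefore work with an abstract coin system: a decidable set P
-- with largest element m whose elements below a₂ are among 1 and a₁, satisfying the
-- two-coin property for all sums u + v ≤ m + (x + d) - 2 (the "window").
--
-- The refutation is a descent on (m, x), lexicographically.  Greedy on x + a₂ yields a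
-- coin w with x + a₂ - 1 ≤ w ≤ x + a₂.  Let y be the largest coin below m.
--   * y + 1 = m:  greedy on y + a₁ leaves a₁ - 1, which is neither 0, 1 nor a coin.
--   * m ≤ y + x, y + 1 < m:  greedy on y + x and y + x + d yields a smaller pair x', x' + d.
--   * y + x + d ≤ m + 1:  drop m; the window still covers everything, and y is the new top.
--   * otherwise greedy on y + x + d forces y + x + d = m + a₁, and then greedy on y + w
--     leaves a remainder strictly between a₁ and 2a₁ ≤ a₂, which cannot be a coin.

open import Defs
open import Data.Nat using (ℕ; zero; suc; _+_; _∸_; _≤_; _<_; s≤s; z≤n; s≤s⁻¹; z<s; >-nonZero; _≤?_; _<?_; _≟_; pred)
open import Data.Nat.Properties
open import Data.Nat.Induction using (<-wellFounded)
open import Data.Nat.Tactic.RingSolver using (solve)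
open import Data.Fin using (Fin; toℕ; fromℕ<; fromℕ)
import Data.Fin as F
import Data.Fin.Properties as FP
open import Data.List using (List; []; _∷_; map)
open import Data.List.Base using (allFin)
open import Data.List.Membership.Propositional using (_∈_)
open import Data.List.Membership.Propositional.Properties using (∈-allFin; ∈-map⁺; ∈-map⁻)
open import Data.List.Relation.Unary.Any using (here; there)
open import Data.Product using (Σ; _×_; _,_; proj₁; proj₂)
open import Data.Sum using (_⊎_; inj₁; inj₂)
open import Data.Empty using (⊥; ⊥-elim)
open import Induction.WellFounded using (Acc; acc)
open import Relation.Nullary using (¬_; Dec; yes; no; _×-dec_)
open import Relation.Unary using (Decidable)
open import Relation.Binary.PropositionalEquality using (_≡_; refl; sym; trans; cong; subst; subst₂; module ≡-Reasoning)

largestBelow-≤ : ∀ c xs → largestBelow c xs ≤ c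
largestBelow-≤ c [] = z≤n
largestBelow-≤ c (x ∷ xs) with x ≤? c
... | yes x≤c = ⊔-lub x≤c (largestBelow-≤ c xs)
... | no _    = largestBelow-≤ c xs

largestBelow-max : ∀ c xs z → z ∈ xs → z ≤ c → z ≤ largestBelow c xs
largestBelow-max c (x ∷ xs) z (here refl) z≤c with x ≤? c
... | yes _   = m≤m⊔n x (largestBelow c xs)
... | no x≰c  = ⊥-elim (x≰c z≤c)
largestBelow-max c (x ∷ xs) z (there z∈xs) z≤c with x ≤? c
... | yes _ = ≤-trans (largestBelow-max c xs z z∈xs z≤c) (m≤n⊔m x (largestBelow c xs))
... | no _  = largestBelow-max c xs z z∈xs z≤c

largestBelow-∈ : ∀ c xs → largestBelow c xs ≡ 0 ⊎ largestBelow c xs ∈ xs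
largestBelow-∈ c [] = inj₁ refl
largestBelow-∈ c (x ∷ xs) with x ≤? c
... | no _ with largestBelow-∈ c xs
...   | inj₁ ≡0  = inj₁ ≡0
...   | inj₂ ∈xs = inj₂ (there ∈xs)
largestBelow-∈ c (x ∷ xs) | yes _ with ⊔-sel x (largestBelow c xs)
...   | inj₁ ≡x = inj₂ (subst (_∈ x ∷ xs) (sym ≡x) (here refl))
...   | inj₂ ≡rest with largestBelow-∈ c xs
...     | inj₁ ≡0  = inj₁ (trans ≡rest ≡0)
...     | inj₂ ∈xs = inj₂ (subst (_∈ x ∷ xs) (sym ≡rest) (there ∈xs))

record IsLargest (P : ℕ → Set) (s g : ℕ) : Set where
  constructor largest
  field
    member  : P g
    bounded : g ≤ s
    maximal : ∀ {c} → P c → c ≤ s → c ≤ g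

largest-unique : ∀ {P s g g′} → IsLargest P s g → IsLargest P s g′ → g ≡ g′
largest-unique (largest pg g≤s max) (largest pg′ g′≤s max′) = ≤-antisym (max′ pg g≤s) (max pg′ g′≤s)

largest-exists : ∀ {P : ℕ → Set} → Decidable P → ∀ n {c} → c ≤ n → P c → Σ ℕ (IsLargest P n)
largest-exists P? n c≤n pc with P? n
... | yes pn = n , largest pn ≤-refl (λ _ z≤n → z≤n)
largest-exists P? zero z≤n pc | no ¬pn = ⊥-elim (¬pn pc)
largest-exists {P} P? (suc n) c≤1+n pc | no ¬pn with m≤n⇒m<n∨m≡n c≤1+n
... | inj₂ refl = ⊥-elim (¬pn pc)
... | inj₁ c<1+n with largest-exists P? n (s≤s⁻¹ c<1+n) pc
...   | g , largest pg g≤n max = g , largest pg (m≤n⇒m≤1+n g≤n) max′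
  where
    -- n + 1 itself is not in P, so the bound n + 1 adds nothing.
    max′ : ∀ {z} → P z → z ≤ suc n → z ≤ g
    max′ pz z≤1+n with m≤n⇒m<n∨m≡n z≤1+n
    ... | inj₂ refl  = ⊥-elim (¬pn pz)
    ... | inj₁ z<1+n = max pz (s≤s⁻¹ z<1+n)

ZeroOrCoin : (ℕ → Set) → ℕ → Set
ZeroOrCoin P r = r ≡ 0 ⊎ P r

positive-coin : ∀ {P r} → 0 < r → ZeroOrCoin P r → P r
positive-coin 0<r (inj₁ refl) = ⊥-elim (n≮0 0<r)
positive-coin _   (inj₂ pr)   = pr

TwoCoinWindow : (ℕ → Set) → ℕ → ℕ → Set
TwoCoinWindow P m b = ∀ {u v g r} → P u → P v → u + v + 2 ≤ m + b →
  IsLargest P (u + v) g → g + r ≡ u + v → ZeroOrCoin P r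

window-shrink : ∀ {P m b b′} → b′ ≤ b → TwoCoinWindow P m b → TwoCoinWindow P m b′
window-shrink {m = m} b′≤b W pu pv win = W pu pv (≤-trans win (+-monoʳ-≤ m b′≤b))

within-window : ∀ {y v m b} → 2 + y ≤ m → v ≤ b → y + v + 2 ≤ m + b
within-window {y} {v} {m} {b} 2+y≤m v≤b = begin
  y + v + 2    ≡⟨ solve (y ∷ v ∷ []) ⟩
  (2 + y) + v  ≤⟨ +-mono-≤ 2+y≤m v≤b ⟩
  m + b        ∎
  where open ≤-Reasoning

Below : (ℕ → Set) → ℕ → ℕ → Set
Below P m c = P c × c < m

-- The window survives passing to the coins below m, provided every sum in the new
-- window stays below m (so that the largest coins ≤ u + v are the same).
window-below : ∀ {P m y b} → y ≤ m → y + b ≤ suc m → TwoCoinWindow P m b → TwoCoinWindow (Below P m) y b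
window-below {P} {m} {y} {b} y≤m y+b≤1+m W {u} {v} {g} {r} (pu , _) (pv , _) win
             (largest (pg , _) g≤ max) g+r≡ = restrict (W pu pv win′ g-largest g+r≡)
  where
    u+v<m : u + v < m
    u+v<m = s≤s⁻¹ (begin
      suc (suc (u + v)) ≡⟨ solve (u ∷ v ∷ []) ⟩
      u + v + 2         ≤⟨ win ⟩
      y + b             ≤⟨ y+b≤1+m ⟩
      suc m             ∎)
      where open ≤-Reasoning
    win′ : u + v + 2 ≤ m + b
    win′ = ≤-trans win (+-monoˡ-≤ b y≤m)
    g-largest : IsLargest P (u + v) g
    g-largest = largest pg g≤ (λ pc c≤ → max (pc , ≤-<-trans c≤ u+v<m) c≤)
    r<m : r < m
    r<m = ≤-<-trans (subst (r ≤_) g+r≡ (m≤n+m r g)) u+v<m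
    restrict : ZeroOrCoin P r → ZeroOrCoin (Below P m) r
    restrict (inj₁ r≡0) = inj₁ r≡0
    restrict (inj₂ pr)  = inj₂ (pr , r<m)

record CoinSystem (a₁ a₂ : ℕ) (P : ℕ → Set) (m : ℕ) : Set where
  field
    coin?   : Decidable P
    small   : ∀ {c} → P c → c < a₂ → c ≡ 1 ⊎ c ≡ a₁
    coin-a₁ : P a₁
    coin-a₂ : P a₂
    coin-m  : P m
    below-m : ∀ {c} → P c → c ≤ m

drop-top : ∀ {a₁ a₂ P m y} → CoinSystem a₁ a₂ P m → a₁ < m → a₂ < m →
  P y → y < m → (∀ {c} → P c → c < m → c ≤ y) → CoinSystem a₁ a₂ (Below P m) y
drop-top {m = m} S a₁<m a₂<m py y<m below-y = record
  { coin?   = λ c → coin? c ×-dec (c <? m)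
  ; small   = λ pc → small (proj₁ pc)
  ; coin-a₁ = coin-a₁ , a₁<m
  ; coin-a₂ = coin-a₂ , a₂<m
  ; coin-m  = py , y<m
  ; below-m = λ pc → below-y (proj₁ pc) (proj₂ pc)
  }
  where open CoinSystem S

module Currency (k : ℕ) (a : Fin (suc k) → ℕ) (cur : IsCurrency k a) where
  open IsCurrency cur

  Coin : ℕ → Set
  Coin c = Σ (Fin (suc k)) λ i → a i ≡ c

  a-mono : ∀ i j → toℕ i ≤ toℕ j → a i ≤ a j
  a-mono i j i≤j with m≤n⇒m<n∨m≡n i≤j
  ... | inj₁ i<j = <⇒≤ (strict i j i<j)
  ... | inj₂ i≡j = ≤-reflexive (cong a (FP.toℕ-injective i≡j))

  coin-1 : Coin 1
  coin-1 = F.zero , a0≡1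

  1≤a : ∀ i → 1 ≤ a i
  1≤a i = subst (_≤ a i) a0≡1 (a-mono F.zero i z≤n)

  largestCoin-largest : ∀ c → 1 ≤ c → IsLargest Coin c (largestCoin k a c)
  largestCoin-largest c 1≤c = largest coin (largestBelow-≤ c values) max
    where
      values : List ℕ
      values = map a (allFin (suc k))
      max : ∀ {z} → Coin z → z ≤ c → z ≤ largestCoin k a c
      max (i , refl) = largestBelow-max c values (a i) (∈-map⁺ a (∈-allFin i))
      coin : Coin (largestCoin k a c)
      coin with largestBelow-∈ c values
      ... | inj₁ ≡0 = ⊥-elim (1+n≰n (subst (1 ≤_) ≡0 (max coin-1 1≤c)))
      ... | inj₂ ∈values with ∈-map⁻ a ∈values
      ...   | i , _ , ≡ai = i , sym ≡ai

  1≤largestCoin : ∀ c → 1 ≤ c → 1 ≤ largestCoin k a c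
  1≤largestCoin c 1≤c = IsLargest.maximal (largestCoin-largest c 1≤c) coin-1 1≤c

  grdFuel≡0 : ∀ f t → t ≤ f → grdFuel k a f t ≡ 0 → t ≡ 0
  grdFuel≡0 f zero _ _ = refl
  grdFuel≡0 (suc f) (suc t) _ ()

  grdFuel≤1 : ∀ f t → t ≤ f → grdFuel k a f t ≤ 1 → ZeroOrCoin Coin t
  grdFuel≤1 f zero _ _ = inj₁ refl
  grdFuel≤1 (suc f) (suc t) (s≤s t≤f) (s≤s rest≤0) = inj₂ (subst Coin g≡1+t member)
    where
      open IsLargest (largestCoin-largest (suc t) (s≤s z≤n))
      g : ℕ
      g = largestCoin k a (suc t)
      rest≡0 : suc t ∸ g ≡ 0
      rest≡0 = grdFuel≡0 f (suc t ∸ g)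
                 (≤-trans (∸-monoʳ-≤ (suc t) (1≤largestCoin (suc t) (s≤s z≤n))) t≤f)
                 (n≤0⇒n≡0 rest≤0)
      g≡1+t : g ≡ suc t
      g≡1+t = ≤-antisym bounded (m∸n≡0⇒m≤n rest≡0)

  greedy-rest : ∀ s → 1 ≤ s → grd k a s ≤ 2 → ZeroOrCoin Coin (s ∸ largestCoin k a s)
  greedy-rest (suc s) 1≤s (s≤s grd≤1) =
    grdFuel≤1 s _ (∸-monoʳ-≤ (suc s) (1≤largestCoin (suc s) 1≤s)) grd≤1

  two-coin : Orderly k a → ∀ m b → TwoCoinWindow Coin m b
  two-coin ord m b {g = g} {r} (i , refl) (j , refl) _ g-largest g+r≡s =
    subst (ZeroOrCoin Coin) (sym r≡rest) (greedy-rest s 1≤s grd≤2)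
    where
      s : ℕ
      s = a i + a j
      1≤s : 1 ≤ s
      1≤s = ≤-trans (1≤a i) (m≤m+n (a i) (a j))
      grd≤2 : grd k a s ≤ 2
      grd≤2 = proj₂ (ord s 1≤s) (i ∷ j ∷ []) (cong (a i +_) (+-identityʳ (a j)))
      r≡rest : r ≡ s ∸ largestCoin k a s
      r≡rest = begin
        r                          ≡⟨ m+n∸m≡n g r ⟨
        g + r ∸ g                  ≡⟨ cong (_∸ g) g+r≡s ⟩
        s ∸ g                      ≡⟨ cong (s ∸_) (largest-unique g-largest (largestCoin-largest s 1≤s)) ⟩
        s ∸ largestCoin k a s      ∎
        where open ≡-Reasoning

  coin-system : ∀ i₁ i₂ → toℕ i₁ ≡ 1 → toℕ i₂ ≡ 2 → CoinSystem (a i₁) (a i₂) Coin (a (fromℕ k))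
  coin-system i₁ i₂ t₁ t₂ = record
    { coin?   = λ c → FP.any? (λ i → a i ≟ c)
    ; small   = small
    ; coin-a₁ = i₁ , refl
    ; coin-a₂ = i₂ , refl
    ; coin-m  = fromℕ k , refl
    ; below-m = λ { (i , refl) → a-mono i (fromℕ k)
                      (subst (toℕ i ≤_) (sym (FP.toℕ-fromℕ k)) (FP.toℕ≤pred[n] i)) }
    }
    where
      small : ∀ {c} → Coin c → c < a i₂ → c ≡ 1 ⊎ c ≡ a i₁
      small (F.zero , refl) _ = inj₁ a0≡1
      small (F.suc F.zero , refl) _ = inj₂ (cong a (FP.toℕ-injective (sym t₁)))
      small (F.suc (F.suc i) , refl) c<a₂ =
        ⊥-elim (<⇒≱ c<a₂ (a-mono i₂ (F.suc (F.suc i)) (subst (_≤ toℕ (F.suc (F.suc i))) (sym t₂) (s≤s (s≤s z≤n)))))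

module Descent (a₁ a₂ d : ℕ) (a₁+d≡1+a₂ : a₁ + d ≡ suc a₂) (a₁<d : a₁ < d) (d+2≤a₂ : d + 2 ≤ a₂) where

  d<a₂ : d < a₂
  d<a₂ = begin-strict
    d      <⟨ m<m+n d z<s ⟩
    d + 2  ≤⟨ d+2≤a₂ ⟩
    a₂     ∎
    where open ≤-Reasoning

  a₁<a₂ : a₁ < a₂
  a₁<a₂ = <-trans a₁<d d<a₂

  3≤a₁ : 3 ≤ a₁
  3≤a₁ = +-cancelʳ-≤ d 3 a₁ (begin
    3 + d      ≡⟨ solve (d ∷ []) ⟩
    d + 2 + 1  ≤⟨ +-monoˡ-≤ 1 d+2≤a₂ ⟩
    a₂ + 1     ≡⟨ +-comm a₂ 1 ⟩
    suc a₂     ≡⟨ a₁+d≡1+a₂ ⟨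
    a₁ + d     ∎)
    where open ≤-Reasoning

  2a₁≤a₂ : a₁ + a₁ ≤ a₂
  2a₁≤a₂ = s≤s⁻¹ (subst (suc (a₁ + a₁) ≤_) a₁+d≡1+a₂ (+-monoʳ-< a₁ a₁<d))

  module SmallCoins {P : ℕ → Set} (small : ∀ {c} → P c → c < a₂ → c ≡ 1 ⊎ c ≡ a₁) where

    no-rem-between : ∀ {r} → a₁ < r → r < a₂ → ¬ ZeroOrCoin P r
    no-rem-between a₁<r _ (inj₁ refl) = n≮0 a₁<r
    no-rem-between a₁<r r<a₂ (inj₂ pr) with small pr r<a₂
    ... | inj₁ refl = <⇒≱ a₁<r (≤-trans (s≤s z≤n) 3≤a₁)
    ... | inj₂ refl = <-irrefl refl a₁<r

    rem-below-a₁ : ∀ {r} → r < a₁ → ZeroOrCoin P r → r ≤ 1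
    rem-below-a₁ _ (inj₁ refl) = z≤n
    rem-below-a₁ r<a₁ (inj₂ pr) with small pr (<-trans r<a₁ a₁<a₂)
    ... | inj₁ refl = ≤-refl
    ... | inj₂ refl = ⊥-elim (<-irrefl refl r<a₁)

    middle-coin : ∀ {r} → 2 ≤ r → r < a₂ → P r → r ≡ a₁
    middle-coin {r} 2≤r r<a₂ pr = other-than-1 (small pr r<a₂)
      where
        other-than-1 : r ≡ 1 ⊎ r ≡ a₁ → r ≡ a₁
        other-than-1 (inj₁ r≡1)  = ⊥-elim (<-irrefl refl (subst (2 ≤_) r≡1 2≤r))
        other-than-1 (inj₂ r≡a₁) = r≡a₁

    -- A pair of coins x, x + d starts at a₁ or above (x + d would otherwise lie in (a₁, a₂)).
    pair-start : ∀ {x} → P x → P (x + d) → a₁ ≤ x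
    pair-start {x} px pxd with a₁ ≤? x
    ... | yes a₁≤x = a₁≤x
    ... | no a₁≰x  = ⊥-elim (no-rem-between (<-≤-trans a₁<d (m≤n+m d x)) x+d<a₂ (inj₂ pxd))
      where
        x+d<a₂ : x + d < a₂
        x+d<a₂ = ≤-trans (s≤s (+-monoˡ-≤ d (rem-below-a₁ (≰⇒> a₁≰x) (inj₂ px))))
                         (subst (_≤ a₂) (+-comm d 2) d+2≤a₂)

  PairFree : (ℕ → Set) → ℕ → ℕ → Set
  PairFree P m x = P x → P (x + d) → TwoCoinWindow P m (x + d) → ⊥

  NoPair : ℕ → Set₁
  NoPair m = ∀ {P} → CoinSystem a₁ a₂ P m → ∀ x → PairFree P m x

  module Step {P : ℕ → Set} {m x : ℕ} (S : CoinSystem a₁ a₂ P m)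
              (px : P x) (pxd : P (x + d)) (W : TwoCoinWindow P m (x + d)) where
    open CoinSystem S
    open SmallCoins small

    a₁≤x : a₁ ≤ x
    a₁≤x = pair-start px pxd

    top-step : ∀ {u v r} → P u → P v → u + v + 2 ≤ m + (x + d) → m + r ≡ u + v → ZeroOrCoin P r
    top-step pu pv win m+r≡ =
      W pu pv win (largest coin-m (subst (m ≤_) m+r≡ (m≤m+n _ _)) (λ pc _ → below-m pc)) m+r≡

    w-largest : Σ ℕ (IsLargest P (x + a₂))
    w-largest = largest-exists coin? (x + a₂) (+-monoʳ-≤ x (<⇒≤ d<a₂)) pxd

    w : ℕ
    w = proj₁ w-largest

    pw : P w
    pw = IsLargest.member (proj₂ w-largest)

    w≤x+a₂ : w ≤ x + a₂
    w≤x+a₂ = IsLargest.bounded (proj₂ w-largest)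

    -- Greedy on x + a₂ takes w and leaves a remainder below a₁, hence at most 1.
    x+a₂≤w+1 : x + a₂ ≤ w + 1
    x+a₂≤w+1 = subst (_≤ w + 1) w+r≡ (+-monoʳ-≤ w r≤1)
      where
        open ≤-Reasoning
        r : ℕ
        r = x + a₂ ∸ w
        w+r≡ : w + r ≡ x + a₂
        w+r≡ = m+[n∸m]≡n w≤x+a₂
        win : x + a₂ + 2 ≤ m + (x + d)
        win = begin
          x + a₂ + 2    ≡⟨ solve (x ∷ a₂ ∷ []) ⟩
          x + (a₂ + 2)  ≤⟨ +-monoʳ-≤ x (+-mono-≤ (below-m coin-a₂) (≤-trans (s≤s (s≤s z≤n)) (≤-trans 3≤a₁ (<⇒≤ a₁<d)))) ⟩
          x + (m + d)   ≡⟨ solve (x ∷ m ∷ d ∷ []) ⟩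
          m + (x + d)   ∎
        -- w ≥ x + d, so r ≤ a₂ - d = a₁ - 1
        d+r≤a₂ : d + r ≤ a₂
        d+r≤a₂ = +-cancelˡ-≤ x (d + r) a₂ (begin
          x + (d + r)  ≡⟨ +-assoc x d r ⟨
          x + d + r    ≤⟨ +-monoˡ-≤ r (IsLargest.maximal (proj₂ w-largest) pxd (+-monoʳ-≤ x (<⇒≤ d<a₂))) ⟩
          w + r        ≡⟨ w+r≡ ⟩
          x + a₂       ∎)
        r<a₁ : r < a₁
        r<a₁ = +-cancelʳ-≤ d (suc r) a₁
                 (subst₂ _≤_ (cong suc (+-comm d r)) (sym a₁+d≡1+a₂) (s≤s d+r≤a₂))
        r≤1 : r ≤ 1
        r≤1 = rem-below-a₁ r<a₁ (W px coin-a₂ win (proj₂ w-largest) w+r≡)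

    x+d<m : x + d < m
    x+d<m = s≤s⁻¹ (begin
      suc (suc (x + d)) ≡⟨ solve (x ∷ d ∷ []) ⟩
      x + (d + 2)       ≤⟨ +-monoʳ-≤ x d+2≤a₂ ⟩
      x + a₂            ≤⟨ x+a₂≤w+1 ⟩
      w + 1             ≤⟨ +-monoˡ-≤ 1 (below-m pw) ⟩
      m + 1             ≡⟨ +-comm m 1 ⟩
      suc m             ∎)
      where open ≤-Reasoning

    y-largest : Σ ℕ (IsLargest P (pred m))
    y-largest = largest-exists coin? (pred m) (<⇒≤pred x+d<m) pxd

    y : ℕ
    y = proj₁ y-largest

    py : P y
    py = IsLargest.member (proj₂ y-largest)

    y<m : y < m
    y<m = m≤pred[n]⇒suc[m]≤n {{>-nonZero (≤-<-trans z≤n x+d<m)}} (IsLargest.bounded (proj₂ y-largest))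

    below-y : ∀ {c} → P c → c < m → c ≤ y
    below-y pc c<m = IsLargest.maximal (proj₂ y-largest) pc (<⇒≤pred c<m)

    -- Case y + 1 = m: greedy on y + a₁ takes m and leaves a₁ - 1 ∉ {0, 1}.
    next-is-predecessor : suc y ≡ m → ⊥
    next-is-predecessor 1+y≡m = <-irrefl refl (≤-trans 3≤a₁ a₁≤2)
      where
        open ≤-Reasoning
        r : ℕ
        r = y + a₁ ∸ m
        m≤y+a₁ : m ≤ y + a₁
        m≤y+a₁ = begin
          m       ≡⟨ 1+y≡m ⟨
          suc y   ≡⟨ +-comm 1 y ⟩
          y + 1   ≤⟨ +-monoʳ-≤ y (≤-trans (s≤s z≤n) 3≤a₁) ⟩
          y + a₁  ∎
        m+r≡ : m + r ≡ y + a₁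
        m+r≡ = m+[n∸m]≡n m≤y+a₁
        two-to-right : ∀ u v → u + v + 2 ≡ suc u + (v + 1)
        two-to-right u v = solve (u ∷ v ∷ [])
        win : y + a₁ + 2 ≤ m + (x + d)
        win = begin
          y + a₁ + 2        ≡⟨ two-to-right y a₁ ⟩
          suc y + (a₁ + 1)  ≡⟨ cong (_+ (a₁ + 1)) 1+y≡m ⟩
          m + (a₁ + 1)      ≤⟨ +-monoʳ-≤ m (≤-trans (≤-reflexive (+-comm a₁ 1)) (≤-trans a₁<d (m≤n+m d x))) ⟩
          m + (x + d)       ∎
        1+r≡a₁ : suc r ≡ a₁
        1+r≡a₁ = +-cancelˡ-≡ y (suc r) a₁ (trans (+-suc y r) (trans (cong (_+ r) 1+y≡m) m+r≡))
        a₁≤2 : a₁ ≤ 2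
        a₁≤2 = subst (_≤ 2) 1+r≡a₁ (s≤s (rem-below-a₁ (≤-reflexive 1+r≡a₁) (top-step py coin-a₁ win m+r≡)))

    -- Case m ≤ y + x, y + 1 < m: greedy on y + x and on y + x + d takes m and leaves a
    -- smaller pair x′, x′ + d, for which the (smaller) window still holds.
    smaller-pair : m ≤ y + x → suc y < m → (∀ {x′} → x′ < x → PairFree P m x′) → ⊥
    smaller-pair m≤y+x 2+y≤m ih = shift (top-step py px (within-window 2+y≤m (m≤m+n x d)) m+x′≡)
      where
        x′ : ℕ
        x′ = y + x ∸ m
        m+x′≡ : m + x′ ≡ y + x
        m+x′≡ = m+[n∸m]≡n m≤y+x
        m+x′+d≡ : m + (x′ + d) ≡ y + (x + d)
        m+x′+d≡ = trans (sym (+-assoc m x′ d)) (trans (cong (_+ d) m+x′≡) (+-assoc y x d))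
        px′d : P (x′ + d)
        px′d = positive-coin {P = P} (<-≤-trans (≤-<-trans z≤n a₁<d) (m≤n+m d x′))
                 (top-step py pxd (within-window 2+y≤m ≤-refl) m+x′+d≡)
        x′<x : x′ < x
        x′<x = +-cancelˡ-< y x′ x (<-≤-trans (+-monoˡ-< x′ y<m) (≤-reflexive m+x′≡))
        shift : ZeroOrCoin P x′ → ⊥
        shift (inj₁ x′≡0) = no-rem-between a₁<d d<a₂ (inj₂ (subst (λ z → P (z + d)) x′≡0 px′d))
        shift (inj₂ px′)  = ih x′<x px′ px′d (window-shrink {P} {m} (+-monoˡ-≤ d (<⇒≤ x′<x)) W)

    -- Case y + x + d ≤ m + 1: dropping m keeps the pair and the window, with top y < m.
    drop-m : y + (x + d) ≤ suc m → (∀ {m′} → m′ < m → NoPair m′) → ⊥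
    drop-m bound ih =
      ih y<m (drop-top S (<-trans a₁<a₂ a₂<m) a₂<m py y<m below-y) x
         (px , ≤-<-trans (m≤m+n x d) x+d<m) (pxd , x+d<m) (window-below {P} (<⇒≤ y<m) bound W)
      where
        a₂<m : a₂ < m
        a₂<m = begin-strict
          a₂      <⟨ n<1+n a₂ ⟩
          suc a₂  ≡⟨ a₁+d≡1+a₂ ⟨
          a₁ + d  ≤⟨ +-monoˡ-≤ d a₁≤x ⟩
          x + d   <⟨ x+d<m ⟩
          m       ∎
          where open ≤-Reasoning

    -- Case y + x < m and m + 1 < y + x + d.  Greedy on y + x + d takes m and leaves a coin
    -- in [2, d), which can only be a₁.
    overshoot-is-a₁ : y + x < m → suc m < y + (x + d) → m + a₁ ≡ y + (x + d)
    overshoot-is-a₁ y+x<m 1+m<s = subst (λ z → m + z ≡ y + (x + d)) r≡a₁ m+r≡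
      where
        open ≤-Reasoning
        r : ℕ
        r = y + (x + d) ∸ m
        m+r≡ : m + r ≡ y + (x + d)
        m+r≡ = m+[n∸m]≡n (≤-trans (n≤1+n m) (<⇒≤ 1+m<s))
        2+y≤m : 2 + y ≤ m
        2+y≤m = begin
          2 + y  ≡⟨ +-comm 2 y ⟩
          y + 2  ≤⟨ +-monoʳ-≤ y (≤-trans (s≤s (s≤s z≤n)) (≤-trans 3≤a₁ a₁≤x)) ⟩
          y + x  <⟨ y+x<m ⟩
          m      ∎
        2≤r : 2 ≤ r
        2≤r = +-cancelˡ-≤ m 2 r (begin
          m + 2        ≡⟨ +-comm m 2 ⟩
          suc (suc m)  ≤⟨ 1+m<s ⟩
          y + (x + d)  ≡⟨ m+r≡ ⟨
          m + r        ∎)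
        r<d : r < d
        r<d = +-cancelˡ-< m r d (begin-strict
          m + r        ≡⟨ m+r≡ ⟩
          y + (x + d)  ≡⟨ +-assoc y x d ⟨
          y + x + d    <⟨ +-monoˡ-< d y+x<m ⟩
          m + d        ∎)
        pr : P r
        pr = positive-coin {P = P} (≤-trans (s≤s z≤n) 2≤r)
               (top-step py pxd (within-window 2+y≤m ≤-refl) m+r≡)
        r≡a₁ : r ≡ a₁
        r≡a₁ = middle-coin 2≤r (<-trans r<d d<a₂) pr

    overshoot-sum : y + x < m → suc m < y + (x + d) → suc (y + (x + a₂)) ≡ m + (a₁ + a₁)
    overshoot-sum y+x<m 1+m<s = begin
      suc (y + (x + a₂))  ≡⟨ +-suc y (x + a₂) ⟨
      y + suc (x + a₂)    ≡⟨ cong (y +_) (+-suc x a₂) ⟨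
      y + (x + suc a₂)    ≡⟨ cong (λ z → y + (x + z)) a₁+d≡1+a₂ ⟨
      y + (x + (a₁ + d))  ≡⟨ pull-out y x a₁ d ⟩
      y + (x + d) + a₁    ≡⟨ cong (_+ a₁) (overshoot-is-a₁ y+x<m 1+m<s) ⟨
      m + a₁ + a₁         ≡⟨ +-assoc m a₁ a₁ ⟩
      m + (a₁ + a₁)       ∎
      where
        open ≡-Reasoning
        pull-out : ∀ u v s t → u + (v + (s + t)) ≡ u + (v + t) + s
        pull-out u v s t = solve (u ∷ v ∷ s ∷ t ∷ [])

    -- Then greedy on y + w, where x + a₂ - 1 ≤ w ≤ x + a₂, takes m and leaves a remainder
    -- in (a₁, 2a₁), hence strictly between a₁ and a₂: impossible.
    wedge : y + x < m → suc m < y + (x + d) → ⊥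
    wedge y+x<m 1+m<s = no-rem-between a₁<r r<a₂ (top-step py pw win m+r≡)
      where
        open ≤-Reasoning
        key : suc (y + (x + a₂)) ≡ m + (a₁ + a₁)
        key = overshoot-sum y+x<m 1+m<s
        y+w≤ : y + w ≤ y + (x + a₂)
        y+w≤ = +-monoʳ-≤ y w≤x+a₂
        move-one : ∀ u v → 1 + (u + (v + 1)) ≡ u + v + 2
        move-one u v = solve (u ∷ v ∷ [])
        lower : m + (a₁ + a₁) ≤ y + w + 2
        lower = begin
          m + (a₁ + a₁)       ≡⟨ key ⟨
          suc (y + (x + a₂))  ≤⟨ s≤s (+-monoʳ-≤ y x+a₂≤w+1) ⟩
          1 + (y + (w + 1))   ≡⟨ move-one y w ⟩
          y + w + 2           ∎
        m≤y+w : m ≤ y + w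
        m≤y+w = +-cancelʳ-≤ 2 m (y + w)
                  (≤-trans (+-monoʳ-≤ m (≤-trans (s≤s (s≤s z≤n)) (≤-trans 3≤a₁ (m≤m+n a₁ a₁)))) lower)
        r : ℕ
        r = y + w ∸ m
        m+r≡ : m + r ≡ y + w
        m+r≡ = m+[n∸m]≡n m≤y+w
        win : y + w + 2 ≤ m + (x + d)
        win = begin
          y + w + 2                ≤⟨ +-monoˡ-≤ 2 y+w≤ ⟩
          y + (x + a₂) + 2         ≡⟨ +-comm (y + (x + a₂)) 2 ⟩
          suc (suc (y + (x + a₂))) ≡⟨ cong suc key ⟩
          suc (m + (a₁ + a₁))      ≡⟨ +-suc m (a₁ + a₁) ⟨
          m + suc (a₁ + a₁)        ≤⟨ +-monoʳ-≤ m (s≤s 2a₁≤a₂) ⟩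
          m + suc a₂               ≡⟨ cong (m +_) a₁+d≡1+a₂ ⟨
          m + (a₁ + d)             ≤⟨ +-monoʳ-≤ m (+-monoˡ-≤ d a₁≤x) ⟩
          m + (x + d)              ∎
        a₁<r : a₁ < r
        a₁<r = +-cancelʳ-≤ 2 (suc a₁) r (begin
          suc a₁ + 2     ≡⟨ +-comm (suc a₁) 2 ⟩
          3 + a₁         ≡⟨ +-comm 3 a₁ ⟩
          a₁ + 3         ≤⟨ +-monoʳ-≤ a₁ 3≤a₁ ⟩
          a₁ + a₁        ≤⟨ +-cancelˡ-≤ m (a₁ + a₁) (r + 2)
                              (≤-trans lower (≤-reflexive (trans (cong (_+ 2) (sym m+r≡)) (+-assoc m r 2)))) ⟩
          r + 2          ∎)
        r<a₂ : r < a₂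
        r<a₂ = ≤-trans (+-cancelˡ-≤ m (suc r) (a₁ + a₁) (begin
          m + suc r           ≡⟨ +-suc m r ⟩
          suc (m + r)         ≡⟨ cong suc m+r≡ ⟩
          suc (y + w)         ≤⟨ s≤s y+w≤ ⟩
          suc (y + (x + a₂))  ≡⟨ key ⟩
          m + (a₁ + a₁)       ∎)) 2a₁≤a₂

    descend : (∀ {m′} → m′ < m → NoPair m′) → (∀ {x′} → x′ < x → PairFree P m x′) → ⊥
    descend ih-m ih-x = cases (m ≤? y + x) (suc y ≟ m) (y + (x + d) ≤? suc m)
      where
        cases : Dec (m ≤ y + x) → Dec (suc y ≡ m) → Dec (y + (x + d) ≤ suc m) → ⊥
        cases (yes m≤y+x) (yes 1+y≡m) _ = next-is-predecessor 1+y≡m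
        cases (yes m≤y+x) (no 1+y≢m)  _ = smaller-pair m≤y+x (≤∧≢⇒< y<m 1+y≢m) ih-x
        cases (no m≰y+x) _ (yes bound)  = drop-m bound ih-m
        cases (no m≰y+x) _ (no unbound) = wedge (≰⇒> m≰y+x) (≰⇒> unbound)

  no-pair : ∀ m → NoPair m
  no-pair m = go m (<-wellFounded m)
    where
      go : ∀ m → Acc _<_ m → NoPair m
      go m (acc smaller-m) {P} S x = go-x x (<-wellFounded x)
        where
          go-x : ∀ x → Acc _<_ x → PairFree P m x
          go-x x (acc smaller-x) px pxd W =
            Step.descend S px pxd W (λ m′<m → go _ (smaller-m m′<m)) (λ x′<x → go-x _ (smaller-x x′<x))

gap-sum : ∀ {a₁ a₂} → a₁ ≤ a₂ → a₁ + (a₂ ∸ a₁ + 1) ≡ suc a₂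
gap-sum {a₁} {a₂} a₁≤a₂ = begin
  a₁ + (a₂ ∸ a₁ + 1)  ≡⟨ +-assoc a₁ (a₂ ∸ a₁) 1 ⟨
  a₁ + (a₂ ∸ a₁) + 1  ≡⟨ cong (_+ 1) (m+[n∸m]≡n a₁≤a₂) ⟩
  a₂ + 1              ≡⟨ +-comm a₂ 1 ⟩
  suc a₂              ∎
  where open ≡-Reasoning

gap-bound : ∀ {a₂ d} → d < a₂ ∸ 1 → d + 2 ≤ a₂
gap-bound {suc a₂} {d} d<a₂-1 = subst (_≤ suc a₂) (+-comm 2 d) (s≤s d<a₂-1)

lemma5p4 : (k : ℕ) (a : Fin (suc k) → ℕ) → IsCurrency k a → Orderly k a →
    (hk : 2 ≤ k) →
    let a₁ = a (fromℕ< {1} (s≤s (≤-trans (n≤1+n 1) hk)))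
        a₂ = a (fromℕ< {2} (s≤s hk))
    in a₁ < a₂ ∸ a₁ + 1 → a₂ ∸ a₁ + 1 < a₂ ∸ 1 →
    ¬ (Σ (Fin (suc k)) λ i → Σ (Fin (suc k)) λ j →
         toℕ i < toℕ j × a j ∸ a i ≡ a₂ ∸ a₁ + 1)
lemma5p4 k a cur ord hk a₁<d d<a₂-1 (i , j , i<j , aj-ai≡d) =
  Descent.no-pair (a i₁) (a i₂) d (gap-sum (<⇒≤ a₁<a₂)) a₁<d (gap-bound d<a₂-1)
    (a (fromℕ k)) (coin-system i₁ i₂ t₁ t₂) (a i) (i , refl) (j , aj≡ai+d) (two-coin ord (a (fromℕ k)) (a i + d))
  where
    open IsCurrency cur
    open Currency k a cur
    1<k+1 : 1 < suc k
    1<k+1 = s≤s (≤-trans (n≤1+n 1) hk)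
    2<k+1 : 2 < suc k
    2<k+1 = s≤s hk
    i₁ i₂ : Fin (suc k)
    i₁ = fromℕ< 1<k+1
    i₂ = fromℕ< 2<k+1
    t₁ : toℕ i₁ ≡ 1
    t₁ = FP.toℕ-fromℕ< 1<k+1
    t₂ : toℕ i₂ ≡ 2
    t₂ = FP.toℕ-fromℕ< 2<k+1
    d : ℕ
    d = a i₂ ∸ a i₁ + 1
    a₁<a₂ : a i₁ < a i₂
    a₁<a₂ = strict i₁ i₂ (subst₂ _<_ (sym t₁) (sym t₂) ≤-refl)
    aj≡ai+d : a j ≡ a i + d
    aj≡ai+d = trans (sym (m+[n∸m]≡n (<⇒≤ (strict i j i<j)))) (cong (a i +_) aj-ai≡d)
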